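{- For each edit type $\mathrm{edit} \in \{\mathrm{sub}, \mathrm{ins}, \mathrm{del}\}$, $\mathrm{AS}_{\mathrm{edit}}(z_{\mathrm{End}}^{\mathrm{opt}}, n) = O(n^{2/3})$.
   Context: Strings are finite sequences over an alphabet; $T[i..j]$ is the substring from position $i$ to $j$. An LZ-End factorization of $T$ is a factorization $T = f_1\cdots f_z$ into nonempty phrases where each phrase $f_k$ is either a single character not occurring in $f_1\cdots f_{k-1}$, or has an occurrence $T[i..j] = f_k$ with $j \le |f_1\cdots f_{k-1}|$ and $j = |f_1\cdots f_h|$ for some $1\le h<k$. $z_{\mathrm{End}}^{\mathrm{opt}}(T)$ is the minimum number of phrases of an LZ-End factorization of $T$. For a measure $c$, $\mathrm{AS}_{\mathrm{edit}}(c,n) = \max\{c(T')-c(T)\}$ over all strings $T$ of length $n$ and all $T'$ obtained from $T$ by a single edit of the given type (substitution, insertion or deletion of one character). -}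

module Defs where

open import Data.Nat using (ℕ; _≤_; _<_)
open import Data.List using (List; []; _∷_; [_]; _++_; concat; take; length)
open import Data.List.Membership.Propositional using (_∉_)
open import Data.Product using (Σ; ∃; ∃-syntax; _×_)
open import Relation.Binary.PropositionalEquality using (_≡_; _≢_)

Suffix : {A : Set} → List A → List A → Set
Suffix f w = ∃[ u ] (u ++ f ≡ w)

-- LZEnd fs : the phrase list fs = f₁ ⋯ f_k satisfies the LZ-End conditions.
-- Phrases are appended at the end; when appending phrase number
-- k = length fs + 1, the previous phrases are fs.
data LZEnd {A : Set} : List (List A) → Set where
  empty : LZEnd []
  fresh : ∀ {fs} (c : A) → LZEnd fs → c ∉ concat fs → LZEnd (fs ++ [ [ c ] ])
  -- a nonempty phrase having an occurrence T[i..j] ending at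
  -- j = |f₁ ⋯ f_h| for some 1 ≤ h < k, i.e. a suffix of f₁ ⋯ f_h
  copy  : ∀ {fs} (f : List A) (h : ℕ) → LZEnd fs → 1 ≤ h → h ≤ length fs →
          f ≢ [] → Suffix f (concat (take h fs)) → LZEnd (fs ++ [ f ])

LZEndFact : {A : Set} → List A → List (List A) → Set
LZEndFact T fs = LZEnd fs × concat fs ≡ T

IsZEndOpt : {A : Set} → List A → ℕ → Set
IsZEndOpt T k =
  (∃[ fs ] (LZEndFact T fs × length fs ≡ k)) ×
  (∀ fs → LZEndFact T fs → k ≤ length fs)

data EditType : Set where
  sub ins del : EditType

SingleEdit : {A : Set} → EditType → List A → List A → Set
SingleEdit sub T T' = ∃[ u ] ∃[ v ] ∃[ a ] ∃[ b ] (T ≡ u ++ a ∷ v × T' ≡ u ++ b ∷ v)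
SingleEdit ins T T' = ∃[ u ] ∃[ v ] ∃[ b ] (T ≡ u ++ v × T' ≡ u ++ b ∷ v)
SingleEdit del T T' = ∃[ u ] ∃[ v ] ∃[ a ] (T ≡ u ++ a ∷ v × T' ≡ u ++ v)

-- Let T = f₁ ⋯ f_z be an LZ-End factorisation and let the edited character a lie in the phrase
-- f_k = α a β.  Keep f₁ ⋯ f_{k-1}, cover α by pieces copied from phrase ends of f₁ ⋯ f_{k-1} (a
-- substring of an LZ-End text needs at most L + 1 such pieces plus one per phrase longer than L),
-- then write the new characters and β.  A later phrase whose source avoids the edited position
-- stays a phrase.  One whose source contains it reads x a y with x a suffix of f₁ ⋯ f_{k-1} α and
-- y a prefix of β f_{k+1} ⋯ f_z, so it is determined by (|x|, |y|); it becomes the three phrases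
-- x, a, y, except that a phrase of length at most L whose pair occurred before copies that earlier
-- occurrence.  Each split costs two phrases and there are at most (L + 1)² short pairs and n / L
-- long phrases, so z' ≤ z + O(L² + n / L), which is O(n^{2/3}) for L = ⌊n^{1/3}⌋.

module Submission where

open import Defs
open import Level using (0ℓ)
open import Data.Nat using (ℕ; zero; suc; _+_; _*_; _∸_; _^_; _≤_; _<_; z≤n; s≤s; _≤?_; _<?_; _≟_; NonZero)
open import Data.Nat.DivMod using (_%_; m<n⇒m%n≡m; [m+kn]%n≡m%n)
open import Data.Nat.Properties
open import Data.List using (List; []; _∷_; [_]; _++_; concat; take; drop; length; map; filter)
open import Data.List.Properties
  using (∷-injective; ∷-injectiveʳ; ++-assoc; ++-identityʳ; ++-conicalʳ; concat-++; concat-[_]; concat-map-[_];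
         length-++; length-map; length-++-≤ˡ; length-++-≤ʳ; take++drop≡id; filter-all; filter-accept; filter-reject)
open import Data.List.Membership.Propositional using (_∈_; _∉_)
open import Data.List.Membership.DecPropositional _≟_ using (_∈?_)
open import Data.List.Membership.Propositional.Properties using (∈-++⁻; ∈-++⁺ˡ; ∈-++⁺ʳ)
open import Data.List.Relation.Unary.Any using (here; there)
open import Data.List.Relation.Unary.All as All using (All; []; _∷_)
open import Data.List.Relation.Unary.All.Properties using (++⁺; map⁺; ¬Any⇒All¬)
open import Data.List.Relation.Unary.Unique.Propositional using (Unique; []; _∷_)
import Data.List.Relation.Unary.Unique.Propositional.Properties as Unique
open import Data.Product using (∃-syntax; _×_; _,_)
open import Data.Sum using (_⊎_; inj₁; inj₂; [_,_]′)
open import Data.Empty using (⊥-elim)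
open import Data.Unit using (⊤; tt)
open import Effect.Monad using (RawMonad)
open import Relation.Nullary using (¬?; Dec; yes; no)
open import Relation.Nullary.Negation using (DoubleNegation; ¬¬-Monad)
open import Relation.Nullary.Decidable using (decidable-stable; ¬¬-excluded-middle)
open import Relation.Binary.PropositionalEquality
  using (_≡_; _≢_; refl; sym; trans; cong; cong₂; subst; subst₂; ≢-sym; module ≡-Reasoning)
open import Function using (_∘_)
open import Data.Nat.Solver using (module +-*-Solver)

-- The alphabet has no decidable equality, so whether a single character is fresh is only decidable
-- classically: the constructions live in the double-negation monad, which is harmless because the
-- inequality finally extracted from them is decidable.
open RawMonad (¬¬-Monad {a = 0ℓ}) using (pure; _>>=_; _<$>_)

-- Prefixes, suffixes and infixes

Prefix : {A : Set} → List A → List A → Set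
Prefix y w = ∃[ r ] (y ++ r ≡ w)

Infix : {A : Set} → List A → List A → Set
Infix s w = ∃[ p ] ∃[ r ] (p ++ s ++ r ≡ w)

++∷≢[] : ∀ {A : Set} (x : List A) {c y} → x ++ c ∷ y ≢ []
++∷≢[] []      ()
++∷≢[] (_ ∷ _) ()

module _ {A : Set} where

  levi : (x y z w : List A) → x ++ y ≡ z ++ w →
         (∃[ m ] (x ≡ z ++ m × w ≡ m ++ y)) ⊎ (∃[ m ] (z ≡ x ++ m × y ≡ m ++ w))
  levi []      y z       w eq = inj₂ (z , refl , eq)
  levi (c ∷ x) y []      w eq = inj₁ (c ∷ x , refl , sym eq)
  levi (c ∷ x) y (d ∷ z) w eq with ∷-injective eq
  ... | refl , eq′ with levi x y z w eq′
  ...   | inj₁ (m , x≡ , w≡) = inj₁ (m , cong (c ∷_) x≡ , w≡)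
  ...   | inj₂ (m , z≡ , y≡) = inj₂ (m , cong (c ∷_) z≡ , y≡)

  ++-absorbˡ : (m y : List A) → length (m ++ y) ≡ length y → m ≡ []
  ++-absorbˡ []      y _  = refl
  ++-absorbˡ (c ∷ m) y eq = ⊥-elim (m≢1+n+m (length y) (sym (trans (cong suc (sym (length-++ m))) eq)))

  Suffix-++ : ∀ {f w} (u : List A) → Suffix f w → Suffix f (u ++ w)
  Suffix-++ {f} u (v , refl) = u ++ v , ++-assoc u v f

  Suffix-trans : ∀ {f g h : List A} → Suffix f g → Suffix g h → Suffix f h
  Suffix-trans {f} (u , refl) (v , refl) = v ++ u , ++-assoc v u f

  Suffix-[] : ∀ {f : List A} → Suffix f [] → f ≡ []
  Suffix-[] {f} (u , eq) = ++-conicalʳ u f eq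

  Suffix-∈ : ∀ {f w} {c : A} → Suffix f w → c ∈ f → c ∈ w
  Suffix-∈ (u , refl) = ∈-++⁺ʳ u

  Suffix-++⁻ : ∀ {f} (x y : List A) → Suffix f (x ++ y) → Suffix f y ⊎ ∃[ s ] (Suffix s x × f ≡ s ++ y)
  Suffix-++⁻ {f} x y (u , eq) with levi u f x y eq
  ... | inj₁ (m , _ , y≡) = inj₁ (m , sym y≡)
  ... | inj₂ (m , x≡ , f≡) = inj₂ (m , (u , sym x≡) , f≡)

  Suffix-∷⁻ : ∀ {f} (c : A) w → Suffix f (c ∷ w) → f ≡ c ∷ w ⊎ Suffix f w
  Suffix-∷⁻ c w ([]    , eq) = inj₁ eq
  Suffix-∷⁻ c w (_ ∷ u , eq) = inj₂ (u , ∷-injectiveʳ eq)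

  Suffix-unique : ∀ {x x′ w : List A} → Suffix x w → Suffix x′ w → length x ≡ length x′ → x ≡ x′
  Suffix-unique {x} {x′} (u , refl) (u′ , eq) len with levi u′ x′ u x eq
  ... | inj₁ (m , _ , x≡)  = trans x≡ (cong (_++ x′) (++-absorbˡ m x′ (trans (cong length (sym x≡)) len)))
  ... | inj₂ (m , _ , x′≡) = sym (trans x′≡ (cong (_++ x) (++-absorbˡ m x (trans (cong length (sym x′≡)) (sym len)))))

  Prefix-trans : ∀ {x y w : List A} → Prefix x y → Prefix y w → Prefix x w
  Prefix-trans {x} (r , refl) (s , refl) = r ++ s , sym (++-assoc x r s)

  Prefix-unique : ∀ {y y′ w : List A} → Prefix y w → Prefix y′ w → length y ≡ length y′ → y ≡ y′
  Prefix-unique {[]}    {[]}      _          _         _   = refl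
  Prefix-unique {[]}    {_ ∷ _}   _          _         ()
  Prefix-unique {_ ∷ _} {[]}      _          _         ()
  Prefix-unique {c ∷ y} {c′ ∷ y′} (r , refl) (r′ , eq) len with ∷-injective eq
  ... | refl , eq′ = cong (c ∷_) (Prefix-unique (r , refl) (r′ , eq′) (suc-injective len))

  Suffix⇒Infix : ∀ {s w : List A} → Suffix s w → Infix s w
  Suffix⇒Infix {s} (u , refl) = u , [] , cong (u ++_) (++-identityʳ s)

  Prefix⇒Infix : ∀ {s w : List A} → Prefix s w → Infix s w
  Prefix⇒Infix (r , eq) = [] , r , eq

  Infix-trans : ∀ {s v w : List A} → Infix s v → Infix v w → Infix s w
  Infix-trans {s} (p , r , refl) (p′ , r′ , refl) = p′ ++ p , r ++ r′ , eq
    where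
    open ≡-Reasoning
    eq : (p′ ++ p) ++ s ++ r ++ r′ ≡ p′ ++ (p ++ s ++ r) ++ r′
    eq = begin
      (p′ ++ p) ++ s ++ r ++ r′   ≡⟨ ++-assoc p′ p (s ++ r ++ r′) ⟩
      p′ ++ p ++ s ++ r ++ r′     ≡⟨ cong (λ t → p′ ++ p ++ t) (++-assoc s r r′) ⟨
      p′ ++ p ++ (s ++ r) ++ r′   ≡⟨ cong (p′ ++_) (++-assoc p (s ++ r) r′) ⟨
      p′ ++ (p ++ s ++ r) ++ r′   ∎

  Infix⇒length≤ : ∀ {s w : List A} → Infix s w → length s ≤ length w
  Infix⇒length≤ {s} (p , r , refl) = ≤-trans (length-++-≤ˡ s) (length-++-≤ʳ (s ++ r) {p})

  Infix-++⁻ : ∀ {s} (x y : List A) → Infix s (x ++ y) →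
              Infix s x ⊎ ∃[ s₁ ] ∃[ s₂ ] (s ≡ s₁ ++ s₂ × Suffix s₁ x × Infix s₂ y)
  Infix-++⁻ {s} x y (p , r , eq) with levi x y (p ++ s) r (trans (sym eq) (sym (++-assoc p s r)))
  ... | inj₁ (m , x≡ , _) = inj₁ (p , m , trans (sym (++-assoc p s m)) (sym x≡))
  ... | inj₂ (m , ps≡ , y≡) with levi p s x m ps≡
  ...   | inj₁ (m′ , _ , m≡) = inj₂ ([] , s , refl , (x , ++-identityʳ x) , (m′ , r , s-inf))
    where
    s-inf : m′ ++ s ++ r ≡ y
    s-inf = trans (sym (++-assoc m′ s r)) (trans (cong (_++ r) (sym m≡)) (sym y≡))
  ...   | inj₂ (m′ , x≡ , s≡) = inj₂ (m′ , m , s≡ , (p , sym x≡) , ([] , r , sym y≡))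

  Suffix-++ʳ : ∀ {f w} (Q : List A) → Suffix f w → Suffix (f ++ Q) (w ++ Q)
  Suffix-++ʳ {f} Q (u , refl) = u , sym (++-assoc u f Q)

  Prefix-++ˡ : ∀ {y w} (x : List A) → Prefix y w → Prefix (x ++ y) (x ++ w)
  Prefix-++ˡ {y} x (r , refl) = r , ++-assoc x y r

  -- Phrase boundaries: Boundary fs P says P = f₁ ⋯ f_h for some 1 ≤ h ≤ |fs|.

  data Boundary : List (List A) → List A → Set where
    here  : ∀ {x xs} → Boundary (x ∷ xs) x
    there : ∀ {x xs P} → Boundary xs P → Boundary (x ∷ xs) (x ++ P)

  Boundary-++⁺ˡ : ∀ {xs P} ys → Boundary xs P → Boundary (xs ++ ys) P
  Boundary-++⁺ˡ ys here      = here
  Boundary-++⁺ˡ ys (there b) = there (Boundary-++⁺ˡ ys b)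

  Boundary-++⁺ʳ : ∀ {ys P} xs → Boundary ys P → Boundary (xs ++ ys) (concat xs ++ P)
  Boundary-++⁺ʳ []       b = b
  Boundary-++⁺ʳ {P = P} (x ∷ xs) b =
    subst (Boundary (x ∷ xs ++ _)) (sym (++-assoc x (concat xs) P)) (there (Boundary-++⁺ʳ xs b))

  Boundary-++⁻ : ∀ {ys P} xs → Boundary (xs ++ ys) P →
                 Boundary xs P ⊎ ∃[ Q ] (Boundary ys Q × P ≡ concat xs ++ Q)
  Boundary-++⁻ []       b         = inj₂ (_ , b , refl)
  Boundary-++⁻ (x ∷ xs) here      = inj₁ here
  Boundary-++⁻ (x ∷ xs) (there b) with Boundary-++⁻ xs b
  ... | inj₁ b′             = inj₁ (there b′)
  ... | inj₂ (Q , b′ , refl) = inj₂ (Q , b′ , sym (++-assoc x (concat xs) Q))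

  Boundary-[-]⁻ : ∀ {x Q} → Boundary [ x ] Q → Q ≡ x
  Boundary-[-]⁻ here = refl

  Boundary-concat : ∀ {xs} → xs ≢ [] → Boundary xs (concat xs)
  Boundary-concat {[]}         ne = ⊥-elim (ne refl)
  Boundary-concat {x ∷ []}     _  = subst (Boundary [ x ]) (sym (++-identityʳ x)) here
  Boundary-concat {x ∷ y ∷ xs} _  = there (Boundary-concat (λ ()))

  Boundary⇒Prefix : ∀ {xs P} → Boundary xs P → Prefix P (concat xs)
  Boundary⇒Prefix {x ∷ xs} here      = concat xs , refl
  Boundary⇒Prefix {x ∷ xs} (there b) with Boundary⇒Prefix b
  ... | r , eq = r , trans (++-assoc x _ r) (cong (x ++_) eq)

  Boundary⇒take : ∀ {xs P} → Boundary xs P → ∃[ h ] (1 ≤ h × h ≤ length xs × P ≡ concat (take h xs))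
  Boundary⇒take {x ∷ xs} here      = 1 , s≤s z≤n , s≤s z≤n , sym (++-identityʳ x)
  Boundary⇒take {x ∷ xs} (there b) with Boundary⇒take b
  ... | h , _ , h≤ , refl = suc h , s≤s z≤n , s≤s h≤ , refl

  take⇒Boundary : ∀ xs h → 1 ≤ h → h ≤ length xs → Boundary xs (concat (take h xs))
  take⇒Boundary (x ∷ xs) 1             _ _        = subst (Boundary (x ∷ xs)) (sym (++-identityʳ x)) here
  take⇒Boundary (x ∷ xs) (suc (suc h)) _ (s≤s h≤) = there (take⇒Boundary xs (suc h) (s≤s z≤n) h≤)

  Boundary₀ : List (List A) → List A → Set
  Boundary₀ xs Q = Q ≡ [] ⊎ Boundary xs Q

  Boundary₀⇒Prefix : ∀ {xs Q} → Boundary₀ xs Q → Prefix Q (concat xs)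
  Boundary₀⇒Prefix {xs} (inj₁ refl) = concat xs , refl
  Boundary₀⇒Prefix      (inj₂ b)    = Boundary⇒Prefix b

  Boundary-∷⁻ : ∀ {x xs Q′} → Boundary (x ∷ xs) Q′ → ∃[ Q ] (Boundary₀ xs Q × Q′ ≡ x ++ Q)
  Boundary-∷⁻ {x} here = [] , inj₁ refl , sym (++-identityʳ x)
  Boundary-∷⁻ (there b) = _ , inj₂ b , refl

  -- LZ-End factorisations, phrase by phrase

  Copyable : List (List A) → List A → Set
  Copyable fs q = q ≢ [] × ∃[ P ] (Boundary fs P × Suffix q P)

  Admissible : List (List A) → List A → Set
  Admissible fs f = (∃[ c ] (f ≡ [ c ] × c ∉ concat fs)) ⊎ Copyable fs f

  AllAdmissible : List (List A) → List (List A) → Set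
  AllAdmissible fs []       = ⊤
  AllAdmissible fs (g ∷ gs) = Admissible fs g × AllAdmissible (fs ++ [ g ]) gs

  Copyable-++ : ∀ {fs q} gs → Copyable fs q → Copyable (fs ++ gs) q
  Copyable-++ gs (q≢[] , P , b , s) = q≢[] , P , Boundary-++⁺ˡ gs b , s

  LZEnd-∷ʳ : ∀ {fs f} → LZEnd fs → Admissible fs f → LZEnd (fs ++ [ f ])
  LZEnd-∷ʳ l (inj₁ (c , refl , c∉)) = fresh c l c∉
  LZEnd-∷ʳ {f = f} l (inj₂ (f≢[] , P , b , s)) with Boundary⇒take b
  ... | h , 1≤h , h≤ , refl = copy f h l 1≤h h≤ f≢[] s

  AllAdmissible-∷ʳ : ∀ fs gs {g} → AllAdmissible fs gs → Admissible (fs ++ gs) g → AllAdmissible fs (gs ++ [ g ])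
  AllAdmissible-∷ʳ fs []       {g} _          ok = subst (λ c → Admissible c g) (++-identityʳ fs) ok , tt
  AllAdmissible-∷ʳ fs (g′ ∷ gs) {g} (ok′ , oks) ok =
    ok′ , AllAdmissible-∷ʳ (fs ++ [ g′ ]) gs oks (subst (λ c → Admissible c g) (sym (++-assoc fs [ g′ ] gs)) ok)

  LZEnd⇒AllAdmissible : ∀ {fs} → LZEnd fs → AllAdmissible [] fs
  LZEnd⇒AllAdmissible empty                      = tt
  LZEnd⇒AllAdmissible (fresh {fs} c l c∉)         =
    AllAdmissible-∷ʳ [] fs (LZEnd⇒AllAdmissible l) (inj₁ (c , refl , c∉))
  LZEnd⇒AllAdmissible (copy {fs} f h l 1≤h h≤ f≢[] s) =
    AllAdmissible-∷ʳ [] fs (LZEnd⇒AllAdmissible l) (inj₂ (f≢[] , _ , take⇒Boundary fs h 1≤h h≤ , s))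

  AllAdmissible-++⁻ : ∀ fs gs {hs} → AllAdmissible fs (gs ++ hs) → AllAdmissible fs gs × AllAdmissible (fs ++ gs) hs
  AllAdmissible-++⁻ fs []       {hs} oks = tt , subst (λ c → AllAdmissible c hs) (sym (++-identityʳ fs)) oks
  AllAdmissible-++⁻ fs (g ∷ gs) {hs} (ok , oks) with AllAdmissible-++⁻ (fs ++ [ g ]) gs oks
  ... | oks₁ , oks₂ = (ok , oks₁) , subst (λ c → AllAdmissible c hs) (++-assoc fs [ g ] gs) oks₂

  AllAdmissible⇒LZEnd : ∀ {fs} gs → LZEnd fs → AllAdmissible fs gs → LZEnd (fs ++ gs)
  AllAdmissible⇒LZEnd {fs} []       l _          = subst LZEnd (sym (++-identityʳ fs)) l
  AllAdmissible⇒LZEnd {fs} (g ∷ gs) l (ok , oks) =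
    subst LZEnd (++-assoc fs [ g ] gs) (AllAdmissible⇒LZEnd gs (LZEnd-∷ʳ l ok) oks)

  concat-∷ʳ : ∀ fs (f : List A) → concat (fs ++ [ f ]) ≡ concat fs ++ f
  concat-∷ʳ fs f = trans (sym (concat-++ fs [ f ])) (cong (concat fs ++_) (concat-[ f ]))

  ∈-concat-take⁻ : ∀ {c : A} fs h → c ∈ concat (take h fs) → c ∈ concat fs
  ∈-concat-take⁻ {c} fs h c∈ =
    subst (c ∈_) (trans (concat-++ (take h fs) (drop h fs)) (cong concat (take++drop≡id h fs))) (∈-++⁺ˡ c∈)

  ∈⇒ends-Boundary : ∀ {fs} {c : A} → LZEnd fs → c ∈ concat fs → ∃[ P ] (Boundary fs P × Suffix [ c ] P)
  ∈⇒ends-Boundary {c = c} (fresh {fs} d l _) c∈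
    with ∈-++⁻ (concat fs) (subst (c ∈_) (concat-∷ʳ fs [ d ]) c∈)
  ... | inj₁ c∈fs with ∈⇒ends-Boundary l c∈fs
  ...   | P , b , s = P , Boundary-++⁺ˡ _ b , s
  ∈⇒ends-Boundary (fresh {fs} d l _) c∈ | inj₂ (here refl) =
    concat fs ++ [ d ] , Boundary-++⁺ʳ fs here , (concat fs , refl)
  ∈⇒ends-Boundary {c = c} (copy {fs} f h l _ _ _ s) c∈
    with ∈-++⁻ (concat fs) (subst (c ∈_) (concat-∷ʳ fs f) c∈)
  ... | inj₁ c∈fs with ∈⇒ends-Boundary l c∈fs
  ...   | P , b , s′ = P , Boundary-++⁺ˡ _ b , s′
  ∈⇒ends-Boundary {c = c} (copy {fs} f h l _ _ _ s) c∈ | inj₂ c∈f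
    with ∈⇒ends-Boundary l (∈-concat-take⁻ fs h (Suffix-∈ s c∈f))
  ... | P , b , s′ = P , Boundary-++⁺ˡ _ b , s′

  [c]-admissible : ∀ {fs} (c : A) → LZEnd fs → DoubleNegation (Admissible fs [ c ])
  [c]-admissible {fs} c l = admissible <$> ¬¬-excluded-middle
    where
    admissible : Dec (c ∈ concat fs) → Admissible fs [ c ]
    admissible (yes c∈) = inj₂ ((λ ()) , ∈⇒ends-Boundary l c∈)
    admissible (no c∉)  = inj₁ (c , refl , c∉)

  Piece : List (List A) → List A → Set
  Piece fs q = (∃[ c ] (q ≡ [ c ])) ⊎ Copyable fs q

  Piece-++ : ∀ {fs q} gs → Piece fs q → Piece (fs ++ gs) q
  Piece-++ gs (inj₁ single) = inj₁ single
  Piece-++ gs (inj₂ cp)     = inj₂ (Copyable-++ gs cp)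

  LZEnd-∷ʳ-Piece : ∀ {fs q} → LZEnd fs → Piece fs q → DoubleNegation (LZEnd (fs ++ [ q ]))
  LZEnd-∷ʳ-Piece l (inj₁ (c , refl)) = LZEnd-∷ʳ l <$> [c]-admissible c l
  LZEnd-∷ʳ-Piece l (inj₂ cp)         = pure (LZEnd-∷ʳ l (inj₂ cp))

  LZEnd-++-Pieces : ∀ {fs} qs → LZEnd fs → All (Piece fs) qs → DoubleNegation (LZEnd (fs ++ qs))
  LZEnd-++-Pieces {fs} []       l []         = pure (subst LZEnd (sym (++-identityʳ fs)) l)
  LZEnd-++-Pieces {fs} (q ∷ qs) l (p ∷ ps) = do
    l′ ← LZEnd-∷ʳ-Piece l p
    subst LZEnd (++-assoc fs [ q ] qs) <$> LZEnd-++-Pieces qs l′ (All.map (Piece-++ [ q ]) ps)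

  -- Covering a substring of an LZ-End text by pieces

  longCount : ℕ → List (List A) → ℕ
  longCount L []       = 0
  longCount L (f ∷ fs) with L <? length f
  ... | yes _ = suc (longCount L fs)
  ... | no _  = longCount L fs

  longCount-++ : ∀ L fs gs → longCount L (fs ++ gs) ≡ longCount L fs + longCount L gs
  longCount-++ L []       gs = refl
  longCount-++ L (f ∷ fs) gs with L <? length f
  ... | yes _ = cong suc (longCount-++ L fs gs)
  ... | no _  = longCount-++ L fs gs

  longCount-++-≤ : ∀ L fs gs → longCount L fs ≤ longCount L (fs ++ gs)
  longCount-++-≤ L fs gs = subst (longCount L fs ≤_) (sym (longCount-++ L fs gs)) (m≤m+n _ _)

  longCount-++-≤ʳ : ∀ L fs gs → longCount L gs ≤ longCount L (fs ++ gs)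
  longCount-++-≤ʳ L fs gs = subst (longCount L gs ≤_) (sym (longCount-++ L fs gs)) (m≤n+m _ _)

  longCount-[long] : ∀ L f → L < length f → longCount L [ f ] ≡ 1
  longCount-[long] L f L<f with L <? length f
  ... | yes _  = refl
  ... | no L≮f = ⊥-elim (L≮f L<f)

  longCount-∷ʳ-long : ∀ L fs f → L < length f → longCount L (fs ++ [ f ]) ≡ suc (longCount L fs)
  longCount-∷ʳ-long L fs f L<f = begin
    longCount L (fs ++ [ f ])         ≡⟨ longCount-++ L fs [ f ] ⟩
    longCount L fs + longCount L [ f ] ≡⟨ cong (longCount L fs +_) (longCount-[long] L f L<f) ⟩
    longCount L fs + 1                 ≡⟨ +-comm (longCount L fs) 1 ⟩
    suc (longCount L fs)               ∎
    where open ≡-Reasoning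

  longCount*suc≤length : ∀ L fs → longCount L fs * suc L ≤ length (concat fs)
  longCount*suc≤length L []       = z≤n
  longCount*suc≤length L (f ∷ fs) with L <? length f
  ... | yes L<f = subst (_ ≤_) (sym (length-++ f)) (+-mono-≤ L<f (longCount*suc≤length L fs))
  ... | no _    = ≤-trans (longCount*suc≤length L fs) (length-++-≤ʳ (concat fs) {f})

  wrap : List A → List (List A)
  wrap []      = []
  wrap (c ∷ x) = [ c ∷ x ]

  concat-wrap : ∀ x → concat (wrap x) ≡ x
  concat-wrap []      = refl
  concat-wrap (c ∷ x) = ++-identityʳ (c ∷ x)

  length-wrap : ∀ x → length (wrap x) ≤ 1
  length-wrap []      = z≤n
  length-wrap (c ∷ x) = s≤s z≤n

  All-wrap : ∀ {P : List A → Set} x → (x ≢ [] → P x) → All P (wrap x)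
  All-wrap []      _ = []
  All-wrap (c ∷ x) p = p (λ ()) ∷ []

  Pieces-singles : ∀ fs x → All (Piece fs) (map [_] x)
  Pieces-singles fs x = map⁺ (All.universal (λ c → inj₁ (c , refl)) x)

  Copyable-Suffix : ∀ {fs q} → q ≢ [] → Suffix q (concat fs) → Copyable fs q
  Copyable-Suffix {[]}      q≢[] s = ⊥-elim (q≢[] (Suffix-[] s))
  Copyable-Suffix {f ∷ fs} q≢[] s = q≢[] , _ , Boundary-concat (λ ()) , s

  concat-wrap-++ : ∀ x qs → concat (wrap x ++ qs) ≡ x ++ concat qs
  concat-wrap-++ x qs = trans (sym (concat-++ (wrap x) qs)) (cong (_++ concat qs) (concat-wrap x))

  length-wrap-++ : ∀ x (qs : List (List A)) → length (wrap x ++ qs) ≤ suc (length qs)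
  length-wrap-++ x qs = ≤-trans (≤-reflexive (length-++ (wrap x))) (+-monoˡ-≤ (length qs) (length-wrap x))

  wrap-Pieces : ∀ {fs s} → Suffix s (concat fs) → All (Piece fs) (wrap s)
  wrap-Pieces {s = s} suf = All-wrap s (λ s≢[] → inj₂ (Copyable-Suffix s≢[] suf))

  PieceCover : ℕ → List (List A) → List A → Set
  PieceCover L fs s = ∃[ qs ] (concat qs ≡ s × All (Piece fs) qs × length qs ≤ longCount L fs + suc L)

  PieceCover-∷ʳ : ∀ {L fs s} f → PieceCover L fs s → PieceCover L (fs ++ [ f ]) s
  PieceCover-∷ʳ {L} {fs} f (qs , cq , ps , len) =
    qs , cq , All.map (Piece-++ [ f ]) ps , ≤-trans len (+-monoˡ-≤ (suc L) (longCount-++-≤ L fs [ f ]))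

  -- A part s₂ of the last phrase f longer than L makes f a long copy, so s₂ already occurs earlier:
  -- each long phrase costs one piece, and only the final stretch is written as ≤ L characters.
  infix-cover-∷ʳ : ∀ {L fs} f → (∀ {s} → Infix s (concat fs) → PieceCover L fs s) →
                   length f ≤ L ⊎ Infix f (concat fs) →
                   ∀ {s} → Infix s (concat fs ++ f) → PieceCover L (fs ++ [ f ]) s
  infix-cover-∷ʳ {L} {fs} f cover f-source s-inf with Infix-++⁻ (concat fs) f s-inf
  ... | inj₁ s-inf′ = PieceCover-∷ʳ f (cover s-inf′)
  ... | inj₂ (s₁ , s₂ , refl , s₁-suf , s₂-inf) with length s₂ ≤? L
  ...   | yes short =
    wrap s₁ ++ map [_] s₂ ,
    trans (concat-wrap-++ s₁ _) (cong (s₁ ++_) (concat-map-[ s₂ ])) ,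
    ++⁺ (All.map (Piece-++ [ f ]) (wrap-Pieces s₁-suf)) (Pieces-singles _ s₂) ,
    ≤-trans (length-wrap-++ s₁ _)
      (≤-trans (s≤s (≤-trans (≤-reflexive (length-map [_] s₂)) short)) (m≤n+m (suc L) _))
  ...   | no long with f-source
  ...     | inj₁ f-short = ⊥-elim (long (≤-trans (Infix⇒length≤ s₂-inf) f-short))
  ...     | inj₂ f-inf with cover (Infix-trans s₂-inf f-inf)
  ...       | qs , cq , ps , len =
    wrap s₁ ++ qs ,
    trans (concat-wrap-++ s₁ qs) (cong (s₁ ++_) cq) ,
    ++⁺ (All.map (Piece-++ [ f ]) (wrap-Pieces s₁-suf)) (All.map (Piece-++ [ f ]) ps) ,
    ≤-trans (length-wrap-++ s₁ qs)
      (≤-trans (s≤s len) (≤-reflexive (cong (_+ suc L) (sym (longCount-∷ʳ-long L fs f f-long)))))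
    where
    f-long : L < length f
    f-long = ≤-trans (≰⇒> long) (Infix⇒length≤ s₂-inf)

  infix-cover : ∀ {L} → 1 ≤ L → ∀ {fs} → LZEnd fs → ∀ {s} → Infix s (concat fs) → PieceCover L fs s
  infix-cover _ empty {[]} _ = [] , refl , [] , z≤n
  infix-cover _ empty {_ ∷ _} s-inf with Infix⇒length≤ s-inf
  ... | ()
  infix-cover 1≤L (fresh {fs} c l _) s-inf =
    infix-cover-∷ʳ [ c ] (infix-cover 1≤L l) (inj₁ 1≤L) (subst (Infix _) (concat-∷ʳ fs [ c ]) s-inf)
  infix-cover 1≤L (copy {fs} f h l 1≤h h≤ _ f-suf) s-inf =
    infix-cover-∷ʳ f (infix-cover 1≤L l) (inj₂ f-inf) (subst (Infix _) (concat-∷ʳ fs f) s-inf)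
    where
    f-inf : Infix f (concat fs)
    f-inf = Infix-trans (Suffix⇒Infix f-suf) (Prefix⇒Infix (Boundary⇒Prefix (take⇒Boundary fs h 1≤h h≤)))

private
  module Without (n : ℕ) where
    ≢n? : (c : ℕ) → Dec (c ≢ n)
    ≢n? c = ¬? (c ≟ n)

    without : List ℕ → List ℕ
    without = filter ≢n?

    length-without : ∀ {cs} → Unique cs → length cs ≤ suc (length (without cs))
    length-without {[]}     []        = z≤n
    length-without {c ∷ cs} (c∉ ∷ u) with c ≟ n
    ... | yes refl = s≤s (≤-reflexive (cong length (sym without-cs≡cs)))
      where
      without-cs≡cs : without (c ∷ cs) ≡ cs
      without-cs≡cs = trans (filter-reject ≢n? (λ c≢c → c≢c refl)) (filter-all ≢n? (All.map ≢-sym c∉))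
    ... | no c≢n   =
      ≤-trans (s≤s (length-without u)) (≤-reflexive (cong (suc ∘ length) (sym (filter-accept ≢n? c≢n))))

    without-< : ∀ {cs} → All (_< suc n) cs → All (_< n) (without cs)
    without-< {[]}     []         = []
    without-< {c ∷ cs} (c< ∷ cs<) with c ≟ n
    ... | yes c≡n = subst (All _) (sym (filter-reject ≢n? (λ c≢n → c≢n c≡n))) (without-< cs<)
    ... | no c≢n  = subst (All _) (sym (filter-accept ≢n? c≢n)) (≤∧≢⇒< (≤-pred c<) c≢n ∷ without-< cs<)

Unique⇒length≤ : ∀ n {cs} → Unique cs → All (_< n) cs → length cs ≤ n
Unique⇒length≤ zero    {[]}    _ _        = z≤n
Unique⇒length≤ zero    {_ ∷ _} _ (() ∷ _)
Unique⇒length≤ (suc n) u cs< =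
  ≤-trans (length-without u) (s≤s (Unique⇒length≤ n (Unique.filter⁺ ≢n? u) (without-< cs<)))
  where open Without n

keep-cost : ∀ {k k′} → k ≤ k′ → 1 + 2 * k ≤ suc (2 * k′)
keep-cost le = s≤s (*-monoʳ-≤ 2 le)

absorb-cost : ∀ {g q d p p′} → g ≤ d + p → q + p ≤ suc p′ → g + q ≤ suc d + p′
absorb-cost {g} {q} {d} {p} {p′} g≤ cost = begin
  g + q       ≤⟨ +-monoˡ-≤ q g≤ ⟩
  d + p + q   ≡⟨ +-assoc d p q ⟩
  d + (p + q) ≡⟨ cong (d +_) (+-comm p q) ⟩
  d + (q + p) ≤⟨ +-monoʳ-≤ d cost ⟩
  d + suc p′  ≡⟨ +-suc d p′ ⟩
  suc d + p′  ∎
  where open ≤-Reasoning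

split-cost : ∀ {q k k′} → q ≤ 3 → k < k′ → q + 2 * k ≤ suc (2 * k′)
split-cost {k = k} q≤3 k<k′ =
  ≤-trans (+-monoˡ-≤ _ q≤3) (s≤s (≤-trans (≤-reflexive (sym (*-distribˡ-+ 2 1 k))) (*-monoʳ-≤ 2 k<k′)))

module _ (M : ℕ) .{{_ : NonZero M}} where

  code : ℕ → ℕ → ℕ
  code x y = y + x * M

  code-injective : ∀ {x y x′ y′} → y < M → y′ < M → code x y ≡ code x′ y′ → x ≡ x′ × y ≡ y′
  code-injective {x} {y} {x′} {y′} y<M y′<M eq = *-cancelʳ-≡ x x′ M (+-cancelˡ-≡ y _ _ eq′) , y≡y′
    where
    open ≡-Reasoning
    y≡y′ : y ≡ y′
    y≡y′ = begin
      y                ≡⟨ m<n⇒m%n≡m y<M ⟨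
      y % M            ≡⟨ [m+kn]%n≡m%n y x M ⟨
      (y + x * M) % M   ≡⟨ cong (_% M) eq ⟩
      (y′ + x′ * M) % M ≡⟨ [m+kn]%n≡m%n y′ x′ M ⟩
      y′ % M           ≡⟨ m<n⇒m%n≡m y′<M ⟩
      y′               ∎
    eq′ : y + x * M ≡ y + x′ * M
    eq′ = trans eq (cong (_+ x′ * M) (sym y≡y′))

code-< : ∀ {L x y} → x ≤ L → y ≤ L → code (suc L) x y < suc L * suc L
code-< {L} {x} {y} x≤L y≤L =
  ≤-trans (+-monoˡ-≤ (x * suc L) (s≤s y≤L)) (+-monoʳ-≤ (suc L) (*-monoˡ-≤ (suc L) x≤L))

-- Refactoring the phrases after the edit.  The old factorisation is pre ++ (α ++ a ∷ β) ∷ post and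
-- new₀ factorises the text up to the end of the edited phrase after the edit; State done holds a
-- refactorisation G of the phrases done of post.

module Refactor {A : Set} (L : ℕ) (pre : List (List A)) (α : List A) (a : A) (β : List A)
                (post new₀ : List (List A))
                (U-boundary : concat pre ++ α ≢ [] → Boundary new₀ (concat pre ++ α))
                (β-suffix : Suffix β (concat new₀))
                (pre-boundary : ∀ {P} → Boundary pre P → Boundary new₀ P) where

  M : ℕ
  M = suc L

  U V : List A
  U = concat pre ++ α
  V = β ++ concat post

  -- The code c stands for a phrase x a y that was split into x, a, y; since x is a suffix of U and
  -- y a prefix of V, the pair (|x|, |y|) encoded by c determines the phrase.
  Recorded : List (List A) → ℕ → Set
  Recorded gs c = ∃[ x ] ∃[ y ] (c ≡ code M (length x) (length y) × length y ≤ L ×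
                                 Suffix x U × Prefix y V × Copyable gs (x ++ a ∷ y))

  Recorded-++ : ∀ {gs c} qs → Recorded gs c → Recorded (gs ++ qs) c
  Recorded-++ qs (x , y , c≡ , y≤L , x-suf , y-pre , cp) = x , y , c≡ , y≤L , x-suf , y-pre , Copyable-++ qs cp

  record Seen (gs : List (List A)) : Set where
    field
      codes    : List ℕ
      unique   : Unique codes
      bounded  : All (_< M * M) codes
      recorded : All (Recorded gs) codes

  open Seen

  Seen-++ : ∀ {gs} qs → Seen gs → Seen (gs ++ qs)
  Seen-++ qs σ = record
    { codes = codes σ ; unique = unique σ ; bounded = bounded σ ; recorded = All.map (Recorded-++ qs) (recorded σ) }

  Seen-insert : ∀ {gs c} (σ : Seen gs) → c ∉ codes σ → c < M * M → Recorded gs c → Seen gs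
  Seen-insert {c = c} σ c∉ c< rec = record
    { codes    = c ∷ codes σ
    ; unique   = ¬Any⇒All¬ (codes σ) c∉ ∷ unique σ
    ; bounded  = c< ∷ bounded σ
    ; recorded = rec ∷ recorded σ
    }

  -- Each split costs two extra phrases, paid for by a new code or a new long phrase.
  Φ : List ℕ → List (List A) → ℕ
  Φ cs done = 2 * (length cs + longCount L done)

  record State (done : List (List A)) : Set where
    field
      G        : List (List A)
      lzend    : LZEnd (new₀ ++ G)
      concat-G : concat G ≡ concat done
      boundary : ∀ {Q} → Boundary done Q → Boundary G Q
      seen     : Seen (new₀ ++ G)
      length-G : length G ≤ length done + Φ (codes seen) done

  extend : ∀ {done f} (st : State done) (qs : List (List A)) → qs ≢ [] → concat qs ≡ f →
           All (Piece (new₀ ++ State.G st)) qs → (σ : Seen ((new₀ ++ State.G st) ++ qs)) →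
           length qs + Φ (codes (State.seen st)) done ≤ suc (Φ (codes σ) (done ++ [ f ])) →
           DoubleNegation (State (done ++ [ f ]))
  extend {done} {f} st qs qs≢[] cq ps σ cost = mk <$> LZEnd-++-Pieces qs lzend ps
    where
    open State st
    boundary′ : ∀ {Q} → Boundary (done ++ [ f ]) Q → Boundary (G ++ qs) Q
    boundary′ b with Boundary-++⁻ done b
    ... | inj₁ b′ = Boundary-++⁺ˡ qs (boundary b′)
    ... | inj₂ (_ , b′ , refl) rewrite Boundary-[-]⁻ b′ =
      subst (Boundary (G ++ qs)) (cong₂ _++_ concat-G cq) (Boundary-++⁺ʳ G (Boundary-concat qs≢[]))
    length′ : length (G ++ qs) ≤ length (done ++ [ f ]) + Φ (codes σ) (done ++ [ f ])
    length′ = subst₂ _≤_ (sym (length-++ G)) (cong (_+ Φ (codes σ) (done ++ [ f ])) (sym length-done++[f]))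
                (absorb-cost {d = length done} {p = Φ (codes seen) done} length-G cost)
      where
      length-done++[f] : length (done ++ [ f ]) ≡ suc (length done)
      length-done++[f] = trans (length-++ done) (+-comm (length done) 1)
    mk : LZEnd ((new₀ ++ G) ++ qs) → State (done ++ [ f ])
    mk l = record
      { G        = G ++ qs
      ; lzend    = subst LZEnd (++-assoc new₀ G qs) l
      ; concat-G = trans (sym (concat-++ G qs)) (trans (cong₂ _++_ concat-G cq) (sym (concat-∷ʳ done f)))
      ; boundary = boundary′
      ; seen     = record { codes = codes σ ; unique = unique σ ; bounded = bounded σ
                          ; recorded = subst (λ gs → All (Recorded gs) (codes σ)) (++-assoc new₀ G qs) (recorded σ) }
      ; length-G = length′
      }

  keep : ∀ {done f} (st : State done) → Piece (new₀ ++ State.G st) f → DoubleNegation (State (done ++ [ f ]))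
  keep {done} {f} st p =
    extend st [ f ] (λ ()) (concat-[ f ]) (p ∷ []) (Seen-++ [ f ] (State.seen st))
      (keep-cost (+-monoʳ-≤ (length (codes (State.seen st))) (longCount-++-≤ L done [ f ])))

  U-copyable : ∀ {gs x} → Suffix x U → x ≢ [] → Copyable (new₀ ++ gs) x
  U-copyable {gs} x-suf x≢[] = x≢[] , U , Boundary-++⁺ˡ gs (U-boundary U≢[]) , x-suf
    where
    U≢[] : U ≢ []
    U≢[] U≡[] = x≢[] (Suffix-[] (subst (Suffix _) U≡[] x-suf))

  βQ-suffix : ∀ {Q s} → Suffix s (β ++ Q) → Suffix s (concat new₀ ++ Q)
  βQ-suffix {Q} s-suf = Suffix-trans s-suf (Suffix-++ʳ Q β-suffix)

  βQ-copyable : ∀ {done Q s} (st : State done) → Boundary₀ done Q → Suffix s (β ++ Q) → s ≢ [] →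
                Copyable (new₀ ++ State.G st) s
  βQ-copyable {s = s} st (inj₁ refl) s-suf s≢[] =
    Copyable-++ (State.G st) (Copyable-Suffix s≢[] (subst (Suffix s) (++-identityʳ _) (βQ-suffix s-suf)))
  βQ-copyable st (inj₂ b) s-suf s≢[] = s≢[] , _ , Boundary-++⁺ʳ new₀ (State.boundary st b) , βQ-suffix s-suf

  Broken : List (List A) → List A → Set
  Broken done f = ∃[ x ] ∃[ Q ] (Suffix x U × Boundary₀ done Q × f ≡ x ++ a ∷ β ++ Q)

  classify : ∀ {done f} (st : State done) → Admissible (pre ++ (α ++ a ∷ β) ∷ done) f →
             Piece (new₀ ++ State.G st) f ⊎ Broken done f
  classify st (inj₁ (c , refl , _)) = inj₁ (inj₁ (c , refl))
  classify {f = f} st (inj₂ (f≢[] , P , b , f-suf)) with Boundary-++⁻ pre b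
  ... | inj₁ b-pre = inj₁ (inj₂ (f≢[] , P , Boundary-++⁺ˡ (State.G st) (pre-boundary b-pre) , f-suf))
  ... | inj₂ (_ , b′ , refl) with Boundary-∷⁻ b′
  ...   | Q , Q₀ , refl with Suffix-++⁻ U (a ∷ β ++ Q) (subst (Suffix f) P≡ f-suf)
    where
    P≡ : concat pre ++ (α ++ a ∷ β) ++ Q ≡ U ++ a ∷ β ++ Q
    P≡ = trans (cong (concat pre ++_) (++-assoc α (a ∷ β) Q)) (sym (++-assoc (concat pre) α (a ∷ β ++ Q)))
  ...     | inj₂ (x , x-suf , f≡) = inj₂ (x , Q , x-suf , Q₀ , f≡)
  ...     | inj₁ f-suf′ with Suffix-∷⁻ a (β ++ Q) f-suf′
  ...       | inj₁ f≡     = inj₂ ([] , Q , (U , ++-identityʳ U) , Q₀ , f≡)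
  ...       | inj₂ f-suf″ = inj₁ (inj₂ (βQ-copyable st Q₀ f-suf″ f≢[]))

  split : List A → List A → List (List A)
  split x y = wrap x ++ [ a ] ∷ wrap y

  concat-split : ∀ x y → concat (split x y) ≡ x ++ a ∷ y
  concat-split x y = trans (concat-wrap-++ x ([ a ] ∷ wrap y)) (cong (λ z → x ++ a ∷ z) (concat-wrap y))

  length-split : ∀ x y → length (split x y) ≤ 3
  length-split x y = ≤-trans (length-wrap-++ x ([ a ] ∷ wrap y)) (s≤s (s≤s (length-wrap y)))

  split-≢[] : ∀ x y → split x y ≢ []
  split-≢[] x y = ++∷≢[] (wrap x) {[ a ]} {wrap y}

  split-Pieces : ∀ {done x Q} (st : State done) → Suffix x U → Boundary₀ done Q →
                 All (Piece (new₀ ++ State.G st)) (split x (β ++ Q))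
  split-Pieces {x = x} {Q} st x-suf Q₀ =
    ++⁺ (All-wrap x (inj₂ ∘ U-copyable x-suf)) (inj₁ (a , refl) ∷ All-wrap (β ++ Q) (inj₂ ∘ βQ-copyable st Q₀ ([] , refl)))

  short-parts : ∀ x y → length (x ++ a ∷ y) ≤ L → length x ≤ L × length y ≤ L
  short-parts x y f≤L = ≤-trans (length-++-≤ˡ x) f≤L , ≤-trans (≤-trans (n≤1+n _) (length-++-≤ʳ (a ∷ y) {x})) f≤L

  reuse : ∀ {gs x y} → Suffix x U → Prefix y V → length y ≤ L →
          Recorded gs (code M (length x) (length y)) → Copyable gs (x ++ a ∷ y)
  reuse x-suf y-pre y≤L (x′ , y′ , c≡ , y′≤L , x′-suf , y′-pre , cp) with code-injective M (s≤s y≤L) (s≤s y′≤L) c≡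
  ... | |x|≡ , |y|≡ rewrite Suffix-unique x-suf x′-suf |x|≡ | Prefix-unique y-pre y′-pre |y|≡ = cp

  record-split : ∀ gs x y → length y ≤ L → Suffix x U → Prefix y V →
                 Recorded (gs ++ split x y) (code M (length x) (length y))
  record-split gs x y y≤L x-suf y-pre =
    x , y , refl , y≤L , x-suf , y-pre ,
    (++∷≢[] x {a} {y} , _ , Boundary-++⁺ʳ gs (Boundary-concat (split-≢[] x y)) ,
     (concat gs , cong (concat gs ++_) (sym (concat-split x y))))

  repair-split : ∀ {done} (st : State done) x y → All (Piece (new₀ ++ State.G st)) (split x y) →
                 Suffix x U → Prefix y V → DoubleNegation (State (done ++ [ x ++ a ∷ y ]))
  repair-split {done} st x y pieces x-suf y-pre with L <? length (x ++ a ∷ y)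
  ... | yes long =
    extend st (split x y) (split-≢[] x y) (concat-split x y) pieces (Seen-++ _ σ)
      (split-cost (length-split x y) (+-monoʳ-< (length (codes σ)) (≤-reflexive (sym (longCount-∷ʳ-long L done _ long)))))
    where
    σ : Seen (new₀ ++ State.G st)
    σ = State.seen st
  ... | no short with short-parts x y (≮⇒≥ short) | code M (length x) (length y) ∈? codes (State.seen st)
  ...   | _ , y≤L | yes c∈ = keep st (inj₂ (reuse x-suf y-pre y≤L (All.lookup (recorded (State.seen st)) c∈)))
  ...   | x≤L , y≤L | no c∉ =
    extend st (split x y) (split-≢[] x y) (concat-split x y) pieces
      (Seen-insert (Seen-++ _ σ) c∉ (code-< x≤L y≤L) (record-split (new₀ ++ State.G st) x y y≤L x-suf y-pre))
      (split-cost (length-split x y) (s≤s (+-monoʳ-≤ (length (codes σ)) (longCount-++-≤ L done [ x ++ a ∷ y ]))))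
    where
    σ : Seen (new₀ ++ State.G st)
    σ = State.seen st

  repair : ∀ {done f} → Prefix (concat done) (concat post) → (st : State done) → Broken done f →
           DoubleNegation (State (done ++ [ f ]))
  repair done-pre st (x , Q , x-suf , Q₀ , refl) =
    repair-split st x (β ++ Q) (split-Pieces st x-suf Q₀) x-suf
      (Prefix-++ˡ β (Prefix-trans (Boundary₀⇒Prefix Q₀) done-pre))

  run : ∀ done rest → done ++ rest ≡ post → AllAdmissible (pre ++ (α ++ a ∷ β) ∷ done) rest →
        State done → DoubleNegation (State post)
  run done []         eq _          st = pure (subst State (trans (sym (++-identityʳ done)) eq) st)
  run done (f ∷ rest) eq (ok , oks) st = do
    st′ ← [ keep st , repair done-pre st ]′ (classify st ok)
    run (done ++ [ f ]) rest (trans (++-assoc done [ f ] rest) eq)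
        (subst (λ fs → AllAdmissible fs rest) (++-assoc pre _ [ f ]) oks) st′
    where
    done-pre : Prefix (concat done) (concat post)
    done-pre = concat (f ∷ rest) , trans (concat-++ done (f ∷ rest)) (cong concat eq)

  initial : LZEnd new₀ → State []
  initial l = record
    { G        = []
    ; lzend    = subst LZEnd (sym (++-identityʳ new₀)) l
    ; concat-G = refl
    ; boundary = λ ()
    ; seen     = record { codes = [] ; unique = [] ; bounded = [] ; recorded = [] }
    ; length-G = z≤n
    }

  refactor : LZEnd new₀ → AllAdmissible (pre ++ [ α ++ a ∷ β ]) post →
             DoubleNegation (∃[ G ] (LZEnd (new₀ ++ G) × concat G ≡ concat post ×
                                     length G ≤ length post + 2 * (M * M + longCount L post)))
  refactor l oks = result <$> run [] post refl oks (initial l)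
    where
    result : State post → ∃[ G ] (LZEnd (new₀ ++ G) × concat G ≡ concat post ×
                                   length G ≤ length post + 2 * (M * M + longCount L post))
    result st = G , lzend , concat-G , ≤-trans length-G (+-monoʳ-≤ (length post) (*-monoʳ-≤ 2 (+-monoˡ-≤ _ codes≤)))
      where
      open State st
      codes≤ : length (codes seen) ≤ M * M
      codes≤ = Unique⇒length≤ (M * M) (unique seen) (bounded seen)

-- The edit

module _ {A : Set} where

  ++∷≡[-]⇒ : ∀ (α : List A) {a β c} → α ++ a ∷ β ≡ [ c ] → α ≡ [] × β ≡ []
  ++∷≡[-]⇒ []      eq = refl , ∷-injectiveʳ eq
  ++∷≡[-]⇒ (_ ∷ α) eq = ⊥-elim (++∷≢[] α (∷-injectiveʳ eq))

  edited-phrase-sources : ∀ {pre α a β} → Admissible pre (α ++ a ∷ β) →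
                          Infix α (concat pre) × (β ≢ [] → Copyable pre β)
  edited-phrase-sources {pre} {α} (inj₁ (c , eq , _)) with ++∷≡[-]⇒ α eq
  ... | refl , refl = ([] , concat pre , refl) , λ β≢[] → ⊥-elim (β≢[] refl)
  edited-phrase-sources {pre} {α} {a} {β} (inj₂ (_ , P , b , suf)) =
    Infix-trans (Prefix⇒Infix (a ∷ β , refl)) (Infix-trans (Suffix⇒Infix suf) (Prefix⇒Infix (Boundary⇒Prefix b))) ,
    λ β≢[] → β≢[] , P , b , Suffix-trans (α ++ [ a ] , ++-assoc α [ a ] β) suf

  Replacement : ℕ → List (List A) → List A → List A → List A → Set
  Replacement L pre α γ β =
    ∃[ Mid ] (All (Piece pre) Mid × concat Mid ≡ α ++ γ ++ β × length Mid ≤ longCount L pre + suc L + suc (length γ) ×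
              (concat pre ++ α ≢ [] → Boundary (pre ++ Mid) (concat pre ++ α)))

  replacement : ∀ {L} → 1 ≤ L → ∀ {pre α a β} → LZEnd pre → Admissible pre (α ++ a ∷ β) → ∀ γ →
                Replacement L pre α γ β
  replacement {L} 1≤L {pre} {α} {a} {β} l ok γ with edited-phrase-sources ok
  ... | α-inf , β-copyable with infix-cover 1≤L l α-inf
  ...   | αs , cαs , ps , len =
    αs ++ γβs ,
    ++⁺ ps (++⁺ (Pieces-singles pre γ) (All-wrap β (inj₂ ∘ β-copyable))) ,
    trans (sym (concat-++ αs γβs)) (cong₂ _++_ cαs concat-γβs) ,
    ≤-trans (≤-reflexive (length-++ αs)) (+-mono-≤ len length-γβs) ,
    U-boundary
    where
    γβs = map [_] γ ++ wrap β
    concat-γβs : concat γβs ≡ γ ++ β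
    concat-γβs = trans (sym (concat-++ (map [_] γ) (wrap β))) (cong₂ _++_ (concat-map-[ γ ]) (concat-wrap β))
    length-γβs : length γβs ≤ suc (length γ)
    length-γβs = ≤-trans (≤-reflexive (length-++ (map [_] γ)))
                   (≤-trans (+-monoʳ-≤ _ (length-wrap β)) (≤-reflexive (trans (+-comm _ 1) (cong suc (length-map [_] γ)))))
    concat-pre-αs : concat (pre ++ αs) ≡ concat pre ++ α
    concat-pre-αs = trans (sym (concat-++ pre αs)) (cong (concat pre ++_) cαs)
    U-boundary : concat pre ++ α ≢ [] → Boundary (pre ++ αs ++ γβs) (concat pre ++ α)
    U-boundary U≢[] = subst₂ Boundary (++-assoc pre αs γβs) concat-pre-αs
      (Boundary-++⁺ˡ {xs = pre ++ αs} γβs (Boundary-concat (λ eq → U≢[] (trans (sym concat-pre-αs) (cong concat eq)))))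

  EditBudget : ℕ → List (List A) → List A → List (List A) → ℕ
  EditBudget L pre γ post = longCount L pre + suc L + length γ + 2 * (suc L * suc L + longCount L post)

  edit-phrase : ∀ {L} → 1 ≤ L → ∀ pre α (a : A) β post γ → LZEnd (pre ++ (α ++ a ∷ β) ∷ post) →
    DoubleNegation (∃[ gs ] (LZEnd gs × concat gs ≡ concat pre ++ α ++ γ ++ β ++ concat post ×
                             length gs ≤ length (pre ++ (α ++ a ∷ β) ∷ post) + EditBudget L pre γ post))
  edit-phrase {L} 1≤L pre α a β post γ l with AllAdmissible-++⁻ [] pre (LZEnd⇒AllAdmissible l)
  ... | oks-pre , ok , oks-post with replacement 1≤L (AllAdmissible⇒LZEnd pre empty oks-pre) ok γ
  ...   | Mid , ps , cMid , length-Mid , U-boundary = do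
    l₀ ← LZEnd-++-Pieces Mid (AllAdmissible⇒LZEnd pre empty oks-pre) ps
    (G , lG , cG , length-G) ← R.refactor l₀ oks-post
    pure ((pre ++ Mid) ++ G , lG , concat-eq G cG , length-eq G length-G)
    where
    concat-pre-Mid : concat (pre ++ Mid) ≡ concat pre ++ α ++ γ ++ β
    concat-pre-Mid = trans (sym (concat-++ pre Mid)) (cong (concat pre ++_) cMid)
    β-suffix : Suffix β (concat (pre ++ Mid))
    β-suffix = subst (Suffix β) (sym concat-pre-Mid) (Suffix-++ (concat pre) (Suffix-++ α (Suffix-++ γ ([] , refl))))
    module R = Refactor L pre α a β post (pre ++ Mid) U-boundary β-suffix (Boundary-++⁺ˡ Mid)
    concat-eq : ∀ G → concat G ≡ concat post → concat ((pre ++ Mid) ++ G) ≡ concat pre ++ α ++ γ ++ β ++ concat post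
    concat-eq G cG = begin
      concat ((pre ++ Mid) ++ G)                     ≡⟨ concat-++ (pre ++ Mid) G ⟨
      concat (pre ++ Mid) ++ concat G                 ≡⟨ cong₂ _++_ concat-pre-Mid cG ⟩
      (concat pre ++ α ++ γ ++ β) ++ concat post      ≡⟨ ++-assoc (concat pre) (α ++ γ ++ β) (concat post) ⟩
      concat pre ++ (α ++ γ ++ β) ++ concat post      ≡⟨ cong (concat pre ++_) (++-assoc α (γ ++ β) (concat post)) ⟩
      concat pre ++ α ++ (γ ++ β) ++ concat post      ≡⟨ cong (λ t → concat pre ++ α ++ t) (++-assoc γ β (concat post)) ⟩
      concat pre ++ α ++ γ ++ β ++ concat post        ∎
      where open ≡-Reasoning
    length-eq : ∀ G → length G ≤ length post + 2 * (suc L * suc L + longCount L post) →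
                length ((pre ++ Mid) ++ G) ≤ length (pre ++ (α ++ a ∷ β) ∷ post) + EditBudget L pre γ post
    length-eq G length-G = begin
      length ((pre ++ Mid) ++ G)                  ≡⟨ trans (length-++ (pre ++ Mid)) (cong (_+ length G) (length-++ pre)) ⟩
      length pre + length Mid + length G          ≤⟨ +-mono-≤ (+-monoʳ-≤ (length pre) length-Mid) length-G ⟩
      length pre + (longCount L pre + suc L + suc (length γ)) + (length post + 2 * (suc L * suc L + longCount L post))
        ≡⟨ budget-arith (length pre) (length post) (longCount L pre) (suc L) (length γ) (2 * (suc L * suc L + longCount L post)) ⟩
      (length pre + suc (length post)) + EditBudget L pre γ post ≡⟨ cong (_+ EditBudget L pre γ post) (length-++ pre) ⟨
      length (pre ++ (α ++ a ∷ β) ∷ post) + EditBudget L pre γ post ∎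
      where
      open ≤-Reasoning
      budget-arith : ∀ p q m k g x → p + (m + k + suc g) + (q + x) ≡ (p + suc q) + (m + k + g + x)
      budget-arith = solve 6 (λ p q m k g x → p :+ (m :+ k :+ (con 1 :+ g)) :+ (q :+ x)
                                             := (p :+ (con 1 :+ q)) :+ (m :+ k :+ g :+ x)) refl
        where open +-*-Solver

  PhraseContaining : List (List A) → List A → A → List A → Set
  PhraseContaining fs u a v =
    ∃[ pre ] ∃[ α ] ∃[ β ] ∃[ post ]
      (fs ≡ pre ++ (α ++ a ∷ β) ∷ post × u ≡ concat pre ++ α × v ≡ β ++ concat post)

  PhraseContaining-∷ : ∀ g {gs u m a v} → u ≡ g ++ m → PhraseContaining gs m a v → PhraseContaining (g ∷ gs) u a v
  PhraseContaining-∷ g u≡ (pre , α , β , post , gs≡ , m≡ , v≡) =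
    g ∷ pre , α , β , post , cong (g ∷_) gs≡ , trans u≡ (trans (cong (g ++_) m≡) (sym (++-assoc g (concat pre) α))) , v≡

  phrase-containing : ∀ fs u a v → concat fs ≡ u ++ a ∷ v → PhraseContaining fs u a v
  phrase-containing []       []      a v ()
  phrase-containing []       (_ ∷ _) a v ()
  phrase-containing (g ∷ gs) u a v eq with levi g (concat gs) u (a ∷ v) eq
  ... | inj₁ (c ∷ m , g≡ , av≡) with ∷-injective av≡
  ...   | refl , v≡ = [] , u , m , gs , cong (_∷ gs) g≡ , refl , v≡
  phrase-containing (g ∷ gs) u a v eq | inj₁ ([] , g≡ , av≡) =
    PhraseContaining-∷ g (trans (sym (++-identityʳ u)) (trans (sym g≡) (sym (++-identityʳ g))))
      (phrase-containing gs [] a v (sym av≡))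
  phrase-containing (g ∷ gs) u a v eq | inj₂ (m , u≡ , gs≡) =
    PhraseContaining-∷ g u≡ (phrase-containing gs m a v gs≡)

  longCount-≤ : ∀ L (fs : List (List A)) → length (concat fs) < suc L ^ 3 → longCount L fs ≤ suc L * suc L
  longCount-≤ L fs n<M³ = <⇒≤ (*-cancelʳ-< M (longCount L fs) (M * M)
    (≤-trans (s≤s (longCount*suc≤length L fs)) (≤-trans n<M³ (≤-reflexive M³≡))))
    where
    M = suc L
    M³≡ : M ^ 3 ≡ M * M * M
    M³≡ = trans (cong (λ t → M * (M * t)) (*-identityʳ M)) (sym (*-assoc M M M))

  EditBudget-≤ : ∀ {L} → 1 ≤ L → ∀ pre γ post → length γ ≤ 2 →
                 longCount L pre ≤ suc L * suc L → longCount L post ≤ suc L * suc L →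
                 EditBudget L pre γ post ≤ 6 * (suc L * suc L)
  EditBudget-≤ {L} 1≤L pre γ post γ≤2 pre≤ post≤ = begin
    lp + M + length γ + 2 * (M * M + lq)   ≡⟨ cong (_+ 2 * (M * M + lq)) (+-assoc lp M (length γ)) ⟩
    lp + (M + length γ) + 2 * (M * M + lq) ≤⟨ +-mono-≤ (+-mono-≤ pre≤ M+γ≤) (*-monoʳ-≤ 2 (+-monoʳ-≤ (M * M) post≤)) ⟩
    M * M + M * M + 2 * (M * M + M * M)    ≡⟨ solve 1 (λ m → m :+ m :+ con 2 :* (m :+ m) := con 6 :* m) refl (M * M) ⟩
    6 * (M * M)                            ∎
    where
    open ≤-Reasoning
    open +-*-Solver
    M lp lq : ℕ
    M  = suc L
    lp = longCount L pre
    lq = longCount L post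
    M+γ≤ : M + length γ ≤ M * M
    M+γ≤ = +-monoʳ-≤ M (≤-trans γ≤2 (*-mono-≤ 1≤L (s≤s 1≤L)))

  edit-in-phrase : ∀ {L} → 1 ≤ L → ∀ {fs} → LZEnd fs → length (concat fs) < suc L ^ 3 →
                   ∀ {u a v} → concat fs ≡ u ++ a ∷ v → ∀ γ → length γ ≤ 2 →
                   DoubleNegation (∃[ gs ] (LZEndFact (u ++ γ ++ v) gs × length gs ≤ length fs + 6 * (suc L * suc L)))
  edit-in-phrase {L} 1≤L {fs} l n<M³ {u} {a} {v} eq γ γ≤2 with phrase-containing fs u a v eq
  ... | pre , α , β , post , refl , refl , refl = do
    (gs , lg , cg , length-gs) ← edit-phrase 1≤L pre α a β post γ l
    pure (gs , (lg , trans cg (sym (++-assoc (concat pre) α (γ ++ β ++ concat post)))) ,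
          ≤-trans length-gs (+-monoʳ-≤ (length fs′) (EditBudget-≤ 1≤L pre γ post γ≤2 pre≤ post≤)))
    where
    fs′ : List (List A)
    fs′ = pre ++ (α ++ a ∷ β) ∷ post
    pre≤ : longCount L pre ≤ suc L * suc L
    pre≤ = ≤-trans (longCount-++-≤ L pre ((α ++ a ∷ β) ∷ post)) (longCount-≤ L fs′ n<M³)
    post≤ : longCount L post ≤ suc L * suc L
    post≤ = ≤-trans (longCount-++-≤ʳ L [ α ++ a ∷ β ] post)
              (≤-trans (longCount-++-≤ʳ L pre ((α ++ a ∷ β) ∷ post)) (longCount-≤ L fs′ n<M³))

  edit-bound : ∀ e {T T′ : List A} {fs} → SingleEdit e T T′ → LZEndFact T fs →
               ∀ {L} → 1 ≤ L → length T < suc L ^ 3 →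
               DoubleNegation (∃[ gs ] (LZEndFact T′ gs × length gs ≤ length fs + 6 * (suc L * suc L)))
  edit-bound sub (u , v , a , b , refl , refl) (l , eq) 1≤L n<M³ =
    edit-in-phrase 1≤L l (subst (λ t → length t < _) (sym eq) n<M³) eq [ b ] (s≤s z≤n)
  edit-bound del (u , v , a , refl , refl) (l , eq) 1≤L n<M³ =
    edit-in-phrase 1≤L l (subst (λ t → length t < _) (sym eq) n<M³) eq [] z≤n
  edit-bound ins (u , a ∷ v , b , refl , refl) (l , eq) 1≤L n<M³ =
    -- inserting b before a replaces a by b a
    edit-in-phrase 1≤L l (subst (λ t → length t < _) (sym eq) n<M³) eq (b ∷ a ∷ []) (s≤s (s≤s z≤n))
  edit-bound ins {fs = fs} (u , [] , b , refl , refl) (l , eq) 1≤L n<M³ = do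
    l′ ← LZEnd-∷ʳ-Piece l (inj₁ (b , refl))
    pure (fs ++ [ [ b ] ] , (l′ , trans (concat-∷ʳ fs [ b ]) (cong (_++ [ b ]) (trans eq (++-identityʳ u)))) ,
          ≤-trans (≤-reflexive (length-++ fs)) (+-monoʳ-≤ (length fs) (s≤s z≤n)))

cube-root : ∀ n → ∃[ L ] (L ^ 3 ≤ n × n < suc L ^ 3)
cube-root zero = 0 , z≤n , s≤s z≤n
cube-root (suc n) with cube-root n
... | L , L³≤n , n<M³ with suc L ^ 3 ≤? suc n
...   | yes M³≤ = suc L , M³≤ , ≤-trans (s≤s n<M³) (^-monoˡ-< 3 (n<1+n (suc L)))
...   | no M³≰  = L , m≤n⇒m≤1+n L³≤n , ≰⇒> M³≰

cube-budget : ∀ l → (6 * ((l + l) * (l + l))) ^ 3 ≡ 13824 * (l ^ 3) ^ 2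
cube-budget = solve 1 (λ l → (con 6 :* ((l :+ l) :* (l :+ l))) :^ 3 := con 13824 :* (l :^ 3) :^ 2) refl
  where open +-*-Solver

1≤cube-root : ∀ {n L} → 1 ≤ n → n < suc L ^ 3 → 1 ≤ L
1≤cube-root {L = zero}  1≤n n<1 = ≤-trans 1≤n (≤-pred n<1)
1≤cube-root {L = suc _} _   _   = s≤s z≤n

excess-bound : ∀ {k k′ n L} → 1 ≤ L → L ^ 3 ≤ n → k′ ≤ k + 6 * (suc L * suc L) → (k′ ∸ k) ^ 3 ≤ 13824 * n ^ 2
excess-bound {k} {k′} {n} {L} 1≤L L³≤n k′≤ = begin
  (k′ ∸ k) ^ 3                   ≤⟨ ^-monoˡ-≤ 3 (m≤n+o⇒m∸n≤o k′ k k′≤) ⟩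
  (6 * (suc L * suc L)) ^ 3      ≤⟨ ^-monoˡ-≤ 3 (*-monoʳ-≤ 6 (*-mono-≤ M≤2L M≤2L)) ⟩
  (6 * ((L + L) * (L + L))) ^ 3  ≡⟨ cube-budget L ⟩
  13824 * (L ^ 3) ^ 2            ≤⟨ *-monoʳ-≤ 13824 (^-monoˡ-≤ 2 L³≤n) ⟩
  13824 * n ^ 2                  ∎
  where
  open ≤-Reasoning
  M≤2L : suc L ≤ L + L
  M≤2L = +-monoˡ-≤ L 1≤L

theorem7 : (e : EditType) → ∃[ C ] ∃[ N₀ ] (∀ {A : Set} (T T' : List A) →
             N₀ ≤ length T → SingleEdit e T T' → (k k' : ℕ) →
             IsZEndOpt T k → IsZEndOpt T' k' →
             (k' ∸ k) ^ 3 ≤ C * length T ^ 2)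
theorem7 e = 13824 , 1 , bound
  where
  bound : ∀ {A : Set} (T T′ : List A) → 1 ≤ length T → SingleEdit e T T′ → (k k′ : ℕ) →
          IsZEndOpt T k → IsZEndOpt T′ k′ → (k′ ∸ k) ^ 3 ≤ 13824 * length T ^ 2
  bound T T′ 1≤n edit _ k′ ((fs , fact , refl) , _) (_ , k′-min) =
    let L , L³≤n , n<M³ = cube-root (length T)
        1≤L = 1≤cube-root {L = L} 1≤n n<M³
    in excess-bound {L = L} 1≤L L³≤n (decidable-stable (k′ ≤? length fs + 6 * (suc L * suc L))
         ((λ (gs , fact′ , len) → ≤-trans (k′-min gs fact′) len) <$> edit-bound e edit fact 1≤L n<M³))
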